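{- For integers $i,j\ge1$ let $N_{i,j}=\frac{1}{i}\binom{i}{j}\binom{i}{j-1}$ (the Narayana numbers). Extend this by $N_{0,0}=1$ and $N_{i,0}=N_{0,j}=0$ for all $i,j>0$. Then for all integers $n\ge0$ and $k\ge 0$, $$s_n((UD)^k)=\sum_{h=0}^{n}\sum_{j=0}^{k-1}\binom{n+h}{n-h}N_{h,j}.$$
   Context: Schröder paths: - A Schröder path is a finite word over $\{U,D,H_2\}$, viewed as a lattice path from $(0,0)$ with steps $U=(1,1)$, $D=(1,-1)$, $H_2=(2,0)$, ending on the $x$-axis and never going below it. The empty path is allowed. - Its semilength is (number of $U$'s) + (number of $H_2$'s). Notation and avoidance: - $(UD)^k$ denotes the word $UD$ repeated $k$ times. - A Schröder path $Q$ avoids $P$ if $P$ does not occur as a (not necessarily contiguous) subword of $Q$. - $s_n(P)$ denotes the number of Schröder paths of semilength $n$ avoiding $P$. -}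

module Defs where

open import Data.Nat using (ℕ; zero; suc; _+_; _*_; _∸_; _/_)
open import Data.Nat.Combinatorics using (_C_)
open import Data.Bool using (Bool; true; false; T)
open import Data.List using (List; []; _∷_; _++_; concat; concatMap; map; length; filter; upTo; replicate)
open import Data.Product using (_×_; _,_)
open import Relation.Nullary using (¬_; Dec; yes; no)
open import Relation.Nullary.Decidable using (_×-dec_; ¬?; T?)
open import Relation.Binary.PropositionalEquality using (_≡_; refl)
import Data.Nat as ℕ
import Data.List.Relation.Binary.Sublist.DecPropositional as SubDec

-- Steps of a Schröder path: U = (1,1), D = (1,-1), H₂ = (2,0).
data Step : Set where
  U D H₂ : Step

_≟S_ : (a b : Step) → Dec (a ≡ b)
U ≟S U = yes refl
U ≟S D = no λ ()
U ≟S H₂ = no λ ()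
D ≟S U = no λ ()
D ≟S D = yes refl
D ≟S H₂ = no λ ()
H₂ ≟S U = no λ ()
H₂ ≟S D = no λ ()
H₂ ≟S H₂ = yes refl

open SubDec _≟S_ public using (_⊆_; _⊆?_)

validFrom : ℕ → List Step → Bool
validFrom zero    []        = true
validFrom (suc _) []        = false
validFrom h       (U ∷ w)   = validFrom (suc h) w
validFrom zero    (D ∷ w)   = false
validFrom (suc h) (D ∷ w)   = validFrom h w
validFrom h       (H₂ ∷ w)  = validFrom h w

IsSchroeder : List Step → Set
IsSchroeder w = T (validFrom 0 w)

semilength : List Step → ℕ
semilength []       = 0
semilength (U ∷ w)  = suc (semilength w)
semilength (D ∷ w)  = semilength w
semilength (H₂ ∷ w) = suc (semilength w)

Avoids : List Step → List Step → Set
Avoids Q P = ¬ (P ⊆ Q)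

UDpow : ℕ → List Step
UDpow zero    = []
UDpow (suc k) = U ∷ D ∷ UDpow k

wordsOfLength : ℕ → List (List Step)
wordsOfLength zero    = [] ∷ []
wordsOfLength (suc m) = concatMap (λ w → (U ∷ w) ∷ (D ∷ w) ∷ (H₂ ∷ w) ∷ []) (wordsOfLength m)

-- all words of length ≤ m (each exactly once); a Schröder path of
-- semilength n has at most 2n letters.
wordsUpTo : ℕ → List (List Step)
wordsUpTo m = concatMap wordsOfLength (upTo (suc m))

GoodPath : ℕ → List Step → List Step → Set
GoodPath n P Q = IsSchroeder Q × (semilength Q ≡ n) × Avoids Q P

goodPath? : ∀ n P Q → Dec (GoodPath n P Q)
goodPath? n P Q = T? (validFrom 0 Q) ×-dec ((semilength Q ℕ.≟ n) ×-dec ¬? (P ⊆? Q))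

s : ℕ → List Step → ℕ
s n P = length (filter (goodPath? n P) (wordsUpTo (2 * n)))

-- Narayana numbers, extended: N 0 0 = 1, N i 0 = N 0 j = 0 for i,j > 0,
-- N i j = (1/i) C(i,j) C(i,j-1) for i,j ≥ 1 (the division is exact).
N : ℕ → ℕ → ℕ
N zero    zero    = 1
N zero    (suc _) = 0
N (suc _) zero    = 0
N (suc i) (suc j) = ((suc i C suc j) * (suc i C j)) / suc i

sumTo : ℕ → (ℕ → ℕ) → ℕ
sumTo zero    f = f 0
sumTo (suc m) f = sumTo m f + f (suc m)

sumBelow : ℕ → (ℕ → ℕ) → ℕ
sumBelow zero    f = 0
sumBelow (suc m) f = sumBelow m f + f m

-- A D step closes a peak when the last non-H₂ step before it is a U; matching such pairs
-- greedily shows that Q contains (UD)^k as a subword iff Q has at least k peaks.  So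
-- s_n((UD)^k) counts Schröder paths of semilength n with fewer than k peaks.  Flat steps
-- affect neither validity nor peaks, so a path with h up steps (hence n − h flat steps and
-- length n + h) is a Dyck path of semilength h with its flat steps placed in C(n+h, n−h)
-- ways, and Dyck paths of semilength h with j peaks are counted by N_{h,j}.  This last count
-- comes from ballot-type closed forms for Dyck paths started at an arbitrary height.  All
-- counting goes through the automaton that reads a word while tracking the height, the
-- semilength still to come, whether a peak is pending and how many peaks are still to come.

module Submission where

open import Defs
open import Data.Bool using (Bool; true; false; T; _∧_)
open import Data.Bool.Properties using (∧-zeroʳ; T-∧)
open import Data.Empty using (⊥-elim)
open import Data.List using (List; []; _∷_; _++_; [_]; concatMap; map; length; filter; upTo)
open import Data.List.Properties using (map-++; applyUpTo-∷ʳ)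
open import Data.List.Relation.Binary.Sublist.Propositional using (_∷_; _∷ʳ_; minimum)
open import Data.Maybe using (Maybe; just; nothing; maybe′)
open import Data.Nat using (ℕ; zero; suc; _+_; _*_; _∸_; _/_; _≤_; _<_; _≡ᵇ_; _<ᵇ_; z≤n; s≤s)
open import Data.Nat.Combinatorics using (_C_; nCk+nC[k+1]≡[n+1]C[k+1]; nC1≡n; k>n⇒nCk≡0)
open import Data.Nat.DivMod using (m*n/n≡m)
open import Data.Nat.ListAction using (sum)
open import Data.Nat.ListAction.Properties using (sum-++)
open import Data.Nat.Properties
open import Algebra.Properties.CommutativeSemigroup +-commutativeSemigroup using (interchange)
open import Data.Nat.Tactic.RingSolver using (solve-∀; solve)
open import Data.Product using (_×_; _,_; proj₁; proj₂)
open import Data.Unit using (tt)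
open import Function using (_∘_; id; _⇔_; mk⇔; Equivalence)
open import Relation.Binary.PropositionalEquality using (_≡_; refl; sym; trans; cong; cong₂; subst; module ≡-Reasoning)
open import Relation.Nullary using (Dec; yes; no; contradiction)
open ≡-Reasoning

private variable
  A B : Set

indicator : Bool → ℕ
indicator true  = 1
indicator false = 0

count : (A → Bool) → List A → ℕ
count b []       = 0
count b (x ∷ xs) = indicator (b x) + count b xs

count-++ : ∀ (b : A → Bool) xs ys → count b (xs ++ ys) ≡ count b xs + count b ys
count-++ b []       ys = refl
count-++ b (x ∷ xs) ys =
  trans (cong (indicator (b x) +_) (count-++ b xs ys)) (sym (+-assoc (indicator (b x)) _ _))

count-concatMap : ∀ (b : A → Bool) (f : B → List A) ys →
                  count b (concatMap f ys) ≡ sum (map (count b ∘ f) ys)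
count-concatMap b f []       = refl
count-concatMap b f (y ∷ ys) =
  trans (count-++ b (f y) (concatMap f ys)) (cong (count b (f y) +_) (count-concatMap b f ys))

count-pointwise-+ : ∀ (b c d : A → Bool) → (∀ x → indicator (b x) ≡ indicator (c x) + indicator (d x)) →
                    ∀ xs → count b xs ≡ count c xs + count d xs
count-pointwise-+ b c d eq []       = refl
count-pointwise-+ b c d eq (x ∷ xs) = begin
  indicator (b x) + count b xs                                 ≡⟨ cong₂ _+_ (eq x) (count-pointwise-+ b c d eq xs) ⟩
  (indicator (c x) + indicator (d x)) + (count c xs + count d xs) ≡⟨ interchange (indicator (c x)) _ _ _ ⟩
  (indicator (c x) + count c xs) + (indicator (d x) + count d xs) ∎

count-cong : ∀ {b c : A → Bool} → (∀ x → b x ≡ c x) → ∀ xs → count b xs ≡ count c xs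
count-cong b≗c []       = refl
count-cong b≗c (x ∷ xs) = cong₂ _+_ (cong indicator (b≗c x)) (count-cong b≗c xs)

count-false : ∀ (b : A → Bool) → (∀ x → b x ≡ false) → ∀ xs → count b xs ≡ 0
count-false b never []       = refl
count-false b never (x ∷ xs) = cong₂ _+_ (cong indicator (never x)) (count-false b never xs)

indicator-<ᵇ-suc : ∀ m k → indicator (m <ᵇ suc k) ≡ indicator (m <ᵇ k) + indicator (m ≡ᵇ k)
indicator-<ᵇ-suc zero    zero    = refl
indicator-<ᵇ-suc zero    (suc k) = refl
indicator-<ᵇ-suc (suc m) zero    = refl
indicator-<ᵇ-suc (suc m) (suc k) = indicator-<ᵇ-suc m k

count-<ᵇ : ∀ (c : A → Bool) (g : A → ℕ) k xs →
           count (λ x → c x ∧ (g x <ᵇ k)) xs ≡ sumBelow k (λ p → count (λ x → c x ∧ (g x ≡ᵇ p)) xs)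
count-<ᵇ c g zero    xs = count-false _ (λ x → ∧-zeroʳ (c x)) xs
count-<ᵇ c g (suc k) xs =
  trans (count-pointwise-+ _ _ _ split xs) (cong (_+ count (λ x → c x ∧ (g x ≡ᵇ k)) xs) (count-<ᵇ c g k xs))
  where
  split : ∀ x → indicator (c x ∧ (g x <ᵇ suc k)) ≡
                 indicator (c x ∧ (g x <ᵇ k)) + indicator (c x ∧ (g x ≡ᵇ k))
  split x with c x
  ... | true  = indicator-<ᵇ-suc (g x) k
  ... | false = refl

length-filter≡count : ∀ {P : A → Set} (P? : ∀ x → Dec (P x)) (b : A → Bool) →
                      (∀ x → P x ⇔ T (b x)) → ∀ xs → length (filter P? xs) ≡ count b xs
length-filter≡count P? b P⇔b []       = refl
length-filter≡count P? b P⇔b (x ∷ xs) with P? x | b x in bx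
... | yes _  | true  = cong suc (length-filter≡count P? b P⇔b xs)
... | yes px | false = ⊥-elim (subst T bx (Equivalence.to (P⇔b x) px))
... | no ¬px | true  = ⊥-elim (¬px (Equivalence.from (P⇔b x) (subst T (sym bx) tt)))
... | no _   | false = length-filter≡count P? b P⇔b xs

count-wordsOfLength-suc : ∀ (b : List Step → Bool) L →
  count b (wordsOfLength (suc L)) ≡
  count (b ∘ (U ∷_)) (wordsOfLength L) + count (b ∘ (D ∷_)) (wordsOfLength L)
    + count (b ∘ (H₂ ∷_)) (wordsOfLength L)
count-wordsOfLength-suc b L = go (wordsOfLength L)
  where
  go : ∀ ws → count b (concatMap (λ w → (U ∷ w) ∷ (D ∷ w) ∷ (H₂ ∷ w) ∷ []) ws) ≡
              count (b ∘ (U ∷_)) ws + count (b ∘ (D ∷_)) ws + count (b ∘ (H₂ ∷_)) ws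
  go []       = refl
  go (w ∷ ws) = trans (cong (λ t → iU + (iD + (iH + t))) (go ws)) (regroup iU iD iH _ _ _)
    where
    iU = indicator (b (U ∷ w))
    iD = indicator (b (D ∷ w))
    iH = indicator (b (H₂ ∷ w))
    regroup : ∀ a b c x y z → a + (b + (c + (x + y + z))) ≡ (a + x) + (b + y) + (c + z)
    regroup = solve-∀

sumTo-cong : ∀ m {f g : ℕ → ℕ} → (∀ i → i ≤ m → f i ≡ g i) → sumTo m f ≡ sumTo m g
sumTo-cong zero    f≗g = f≗g 0 z≤n
sumTo-cong (suc m) f≗g =
  cong₂ _+_ (sumTo-cong m (λ i i≤m → f≗g i (m≤n⇒m≤1+n i≤m))) (f≗g (suc m) ≤-refl)

sumBelow-cong : ∀ k {f g : ℕ → ℕ} → (∀ i → f i ≡ g i) → sumBelow k f ≡ sumBelow k g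
sumBelow-cong zero    f≗g = refl
sumBelow-cong (suc k) f≗g = cong₂ _+_ (sumBelow-cong k f≗g) (f≗g k)

sumBelow-zero : ∀ k {f : ℕ → ℕ} → (∀ i → f i ≡ 0) → sumBelow k f ≡ 0
sumBelow-zero zero    f≗0 = refl
sumBelow-zero (suc k) f≗0 = cong₂ _+_ (sumBelow-zero k f≗0) (f≗0 k)

sumTo-last : ∀ n {f : ℕ → ℕ} → (∀ i → i < n → f i ≡ 0) → sumTo n f ≡ f n
sumTo-last zero    f≗0 = refl
sumTo-last (suc n) {f} f≗0 =
  cong (_+ f (suc n)) (trans (sumTo-last n (λ i i<n → f≗0 i (m<n⇒m<1+n i<n))) (f≗0 n ≤-refl))

sumTo-+ : ∀ n m {f : ℕ → ℕ} → (∀ i → i < n → f i ≡ 0) →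
          sumTo (n + m) f ≡ sumTo m (λ i → f (n + i))
sumTo-+ n zero    f≗0 rewrite +-identityʳ n = sumTo-last n f≗0
sumTo-+ n (suc m) {f} f≗0 rewrite +-suc n m = cong (_+ f (suc (n + m))) (sumTo-+ n m f≗0)

sum-map-upTo : ∀ (g : ℕ → ℕ) m → sum (map g (upTo (suc m))) ≡ sumTo m g
sum-map-upTo g zero    = +-identityʳ (g 0)
sum-map-upTo g (suc m) = begin
  sum (map g (upTo (suc (suc m))))             ≡⟨ cong (sum ∘ map g) (applyUpTo-∷ʳ id (suc m)) ⟨
  sum (map g (upTo (suc m) ++ [ suc m ]))       ≡⟨ cong sum (map-++ g (upTo (suc m)) [ suc m ]) ⟩
  sum (map g (upTo (suc m)) ++ [ g (suc m) ])   ≡⟨ sum-++ (map g (upTo (suc m))) _ ⟩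
  sum (map g (upTo (suc m))) + (g (suc m) + 0)  ≡⟨ cong₂ _+_ (sum-map-upTo g m) (+-identityʳ _) ⟩
  sumTo m g + g (suc m)                         ∎

peaks : Bool → List Step → ℕ
peaks afterUp []       = 0
peaks afterUp (U ∷ w)  = peaks true w
peaks true    (D ∷ w)  = suc (peaks false w)
peaks false   (D ∷ w)  = peaks false w
peaks afterUp (H₂ ∷ w) = peaks afterUp w

peaks-false≤true : ∀ w → peaks false w ≤ peaks true w
peaks-false≤true []       = z≤n
peaks-false≤true (U ∷ w)  = ≤-refl
peaks-false≤true (D ∷ w)  = n≤1+n _
peaks-false≤true (H₂ ∷ w) = peaks-false≤true w

peaks-true≤suc-false : ∀ w → peaks true w ≤ suc (peaks false w)
peaks-true≤suc-false []       = z≤n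
peaks-true≤suc-false (U ∷ w)  = n≤1+n _
peaks-true≤suc-false (D ∷ w)  = ≤-refl
peaks-true≤suc-false (H₂ ∷ w) = peaks-true≤suc-false w

UDpow⊆⇒≤peaks   : ∀ k w → UDpow k ⊆ w → k ≤ peaks false w
D∷UDpow⊆⇒<peaks : ∀ k w → (D ∷ UDpow k) ⊆ w → k < peaks true w

UDpow⊆⇒≤peaks zero    w        _            = z≤n
UDpow⊆⇒≤peaks (suc k) (U ∷ w)  (.U ∷ʳ sub)  = ≤-trans (UDpow⊆⇒≤peaks (suc k) w sub) (peaks-false≤true w)
UDpow⊆⇒≤peaks (suc k) (U ∷ w)  (refl ∷ sub) = D∷UDpow⊆⇒<peaks k w sub
UDpow⊆⇒≤peaks (suc k) (D ∷ w)  (.D ∷ʳ sub)  = UDpow⊆⇒≤peaks (suc k) w sub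
UDpow⊆⇒≤peaks (suc k) (H₂ ∷ w) (.H₂ ∷ʳ sub) = UDpow⊆⇒≤peaks (suc k) w sub

D∷UDpow⊆⇒<peaks k (U ∷ w)  (.U ∷ʳ sub)  = D∷UDpow⊆⇒<peaks k w sub
D∷UDpow⊆⇒<peaks k (D ∷ w)  (.D ∷ʳ sub)  = ≤-trans (D∷UDpow⊆⇒<peaks k w sub) (peaks-true≤suc-false w)
D∷UDpow⊆⇒<peaks k (D ∷ w)  (refl ∷ sub) = s≤s (UDpow⊆⇒≤peaks k w sub)
D∷UDpow⊆⇒<peaks k (H₂ ∷ w) (.H₂ ∷ʳ sub) = D∷UDpow⊆⇒<peaks k w sub

≤peaks⇒UDpow⊆   : ∀ k w → k ≤ peaks false w → UDpow k ⊆ w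
<peaks⇒D∷UDpow⊆ : ∀ k w → k < peaks true w → (D ∷ UDpow k) ⊆ w

≤peaks⇒UDpow⊆ zero    w        _ = minimum w
≤peaks⇒UDpow⊆ (suc k) (U ∷ w)  k<p = refl ∷ <peaks⇒D∷UDpow⊆ k w k<p
≤peaks⇒UDpow⊆ (suc k) (D ∷ w)  k≤p = D ∷ʳ ≤peaks⇒UDpow⊆ (suc k) w k≤p
≤peaks⇒UDpow⊆ (suc k) (H₂ ∷ w) k≤p = H₂ ∷ʳ ≤peaks⇒UDpow⊆ (suc k) w k≤p

<peaks⇒D∷UDpow⊆ k (U ∷ w)  k<p       = U ∷ʳ <peaks⇒D∷UDpow⊆ k w k<p
<peaks⇒D∷UDpow⊆ k (D ∷ w)  (s≤s k≤p) = refl ∷ ≤peaks⇒UDpow⊆ k w k≤p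
<peaks⇒D∷UDpow⊆ k (H₂ ∷ w) k<p       = H₂ ∷ʳ <peaks⇒D∷UDpow⊆ k w k<p

UDpow⊆⇔≤peaks : ∀ k w → UDpow k ⊆ w ⇔ k ≤ peaks false w
UDpow⊆⇔≤peaks k w = mk⇔ (UDpow⊆⇒≤peaks k w) (≤peaks⇒UDpow⊆ k w)

module Automaton {S : Set} (step : Step → S → Maybe S) (accepting : S → Bool) where

  accepts : S → List Step → Bool
  accepts s []      = accepting s
  accepts s (x ∷ w) = maybe′ (λ s′ → accepts s′ w) false (step x s)

  paths : ℕ → S → ℕ
  after : ℕ → Step → S → ℕ

  paths zero    s = indicator (accepting s)
  paths (suc L) s = after L U s + after L D s + after L H₂ s

  after L x s = maybe′ (paths L) 0 (step x s)

  count-accepts : ∀ L s → count (accepts s) (wordsOfLength L) ≡ paths L s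
  count-accepts zero    s = +-identityʳ _
  count-accepts (suc L) s = trans (count-wordsOfLength-suc (accepts s) L)
    (cong₂ _+_ (cong₂ _+_ (count-after U) (count-after D)) (count-after H₂))
    where
    count-after : ∀ x → count (accepts s ∘ (x ∷_)) (wordsOfLength L) ≡ after L x s
    count-after x with step x s
    ... | just s′ = count-accepts L s′
    ... | nothing = count-false _ (λ _ → refl) (wordsOfLength L)

  after-vanishes : ∀ L x s → (∀ s′ → step x s ≡ just s′ → paths L s′ ≡ 0) → after L x s ≡ 0
  after-vanishes L x s succ≡0 with step x s
  ... | just s′ = succ≡0 s′ refl
  ... | nothing = refl

  paths-suc-vanishes : ∀ L s → (∀ x s′ → step x s ≡ just s′ → paths L s′ ≡ 0) → paths (suc L) s ≡ 0
  paths-suc-vanishes L s succ≡0 =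
    cong₂ _+_ (cong₂ _+_ (after-vanishes L U s (succ≡0 U)) (after-vanishes L D s (succ≡0 D)))
              (after-vanishes L H₂ s (succ≡0 H₂))

  module _ (size : S → ℕ) where

    paths-below-size : (∀ {x s s′} → step x s ≡ just s′ → size s ≤ suc (size s′)) →
                       (∀ {s} → T (accepting s) → size s ≡ 0) →
                       ∀ L s → L < size s → paths L s ≡ 0
    paths-below-size drop≤1 accept⇒0 zero s 0<size with accepting s in acc
    ... | false = refl
    ... | true  = contradiction (sym (accept⇒0 (subst T (sym acc) _))) (<⇒≢ 0<size)
    paths-below-size drop≤1 accept⇒0 (suc L) s L<size = paths-suc-vanishes L s λ x s′ st →
      paths-below-size drop≤1 accept⇒0 L s′ (≤-pred (≤-trans L<size (drop≤1 st)))

    paths-above-size : (∀ {x s s′} → step x s ≡ just s′ → size s′ < size s) →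
                       ∀ L s → size s < L → paths L s ≡ 0
    paths-above-size shrink (suc L) s size<1+L = paths-suc-vanishes L s λ x s′ st →
      paths-above-size shrink L s′ (<-≤-trans (shrink st) (≤-pred size<1+L))

record Config : Set where
  constructor config
  field
    height    : ℕ
    remaining : ℕ
    afterUp   : Bool
    peaksLeft : ℕ

step : Step → Config → Maybe Config
step U  (config h (suc m) f p)          = just (config (suc h) m true p)
step D  (config (suc h) m false p)      = just (config h m false p)
step D  (config (suc h) m true (suc p)) = just (config h m false p)
step H₂ (config h (suc m) f p)          = just (config h m f p)
step _  _                               = nothing

accepting : Config → Bool
accepting (config zero zero _ zero) = true
accepting _                         = false

open Automaton step accepting public

false≡[∧false]∧ : ∀ x y → false ≡ (x ∧ false) ∧ y
false≡[∧false]∧ x y = cong (_∧ y) (sym (∧-zeroʳ x))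

accepts-config : ∀ h m f p w →
  accepts (config h m f p) w ≡ (validFrom h w ∧ (semilength w ≡ᵇ m)) ∧ (peaks f w ≡ᵇ p)
accepts-config zero    zero    f zero    []       = refl
accepts-config zero    zero    f (suc p) []       = refl
accepts-config zero    (suc m) f p       []       = refl
accepts-config (suc h) m       f p       []       = refl
accepts-config zero    (suc m) f p       (U ∷ w)  = accepts-config 1 m true p w
accepts-config (suc h) (suc m) f p       (U ∷ w)  = accepts-config (suc (suc h)) m true p w
accepts-config h       zero    f p       (U ∷ w)  =
  false≡[∧false]∧ (validFrom h (U ∷ w)) (peaks true w ≡ᵇ p)
accepts-config zero    m       f p       (D ∷ w)  = refl
accepts-config (suc h) m       false p   (D ∷ w)  = accepts-config h m false p w
accepts-config (suc h) m       true zero (D ∷ w)  = sym (∧-zeroʳ _)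
accepts-config (suc h) m       true (suc p) (D ∷ w) = accepts-config h m false p w
accepts-config zero    (suc m) f p       (H₂ ∷ w) = accepts-config zero m f p w
accepts-config (suc h) (suc m) f p       (H₂ ∷ w) = accepts-config (suc h) m f p w
accepts-config h       zero    f p       (H₂ ∷ w) =
  false≡[∧false]∧ (validFrom h (H₂ ∷ w)) (peaks f w ≡ᵇ p)

lowerSize upperSize : Config → ℕ
lowerSize (config h m _ _) = h + m
upperSize (config h m _ _) = h + (m + m)

step-sizes : ∀ {x s s′} → step x s ≡ just s′ →
             lowerSize s ≤ suc (lowerSize s′) × upperSize s′ < upperSize s
step-sizes {U}  {config h (suc m) f p}          refl =
  ≤-trans (≤-reflexive (+-suc h m)) (n≤1+n _) , ≤-reflexive (up h m)
  where up : ∀ h m → suc (suc h + (m + m)) ≡ h + (suc m + suc m)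
        up = solve-∀
step-sizes {D}  {config (suc h) m false p}      refl = ≤-refl , ≤-refl
step-sizes {D}  {config (suc h) m true (suc p)} refl = ≤-refl , ≤-refl
step-sizes {H₂} {config h (suc m) f p}          refl =
  ≤-reflexive (+-suc h m) , ≤-trans (n≤1+n _) (≤-reflexive (flat h m))
  where flat : ∀ h m → suc (suc (h + (m + m))) ≡ h + (suc m + suc m)
        flat = solve-∀

accepting⇒lowerSize≡0 : ∀ {s} → T (accepting s) → lowerSize s ≡ 0
accepting⇒lowerSize≡0 {config zero zero _ zero} _ = refl

paths-below : ∀ L h m f p → L < h + m → paths L (config h m f p) ≡ 0
paths-below L h m f p =
  paths-below-size lowerSize (proj₁ ∘ step-sizes) accepting⇒lowerSize≡0 L (config h m f p)


paths-above : ∀ L h m f p → h + (m + m) < L → paths L (config h m f p) ≡ 0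
paths-above L h m f p = paths-above-size upperSize (proj₂ ∘ step-sizes) L (config h m f p)


pascal : ∀ n k → suc n C suc k ≡ n C k + n C suc k
pascal n k = sym (nCk+nC[k+1]≡[n+1]C[k+1] n k)

C-absorb : ∀ n k → suc n * (n C k) ≡ suc k * (suc n C suc k)
C-absorb zero    zero    = refl
C-absorb zero    (suc k) = sym (*-zeroʳ (suc (suc k)))
C-absorb (suc n) zero    = begin
  suc (suc n) * 1        ≡⟨ *-identityʳ (suc (suc n)) ⟩
  suc (suc n)            ≡⟨ nC1≡n (suc (suc n)) ⟨
  suc (suc n) C 1        ≡⟨ *-identityˡ _ ⟨
  1 * (suc (suc n) C 1)  ∎
C-absorb (suc n) (suc k) = begin
  suc (suc n) * x                                  ≡⟨ cong (λ t → x + suc n * t) (pascal n k) ⟩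
  x + suc n * (n C k + n C suc k)                  ≡⟨ cong (x +_) (*-distribˡ-+ (suc n) (n C k) _) ⟩
  x + (suc n * (n C k) + suc n * (n C suc k))      ≡⟨ cong₂ (λ a b → x + (a + b)) (C-absorb n k) (C-absorb n (suc k)) ⟩
  x + (suc k * x + suc (suc k) * y)                ≡⟨ regroup k x y ⟩
  suc (suc k) * (x + y)                            ≡⟨ cong (suc (suc k) *_) (pascal (suc n) (suc k)) ⟨
  suc (suc k) * (suc (suc n) C suc (suc k))        ∎
  where
  x = suc n C suc k
  y = suc n C suc (suc k)
  regroup : ∀ k x y → x + (suc k * x + suc (suc k) * y) ≡ suc (suc k) * (x + y)
  regroup = solve-∀

C-absorb-complement : ∀ n k → suc n * (n C k) + k * (suc n C k) ≡ suc n * (suc n C k)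
C-absorb-complement n zero    = +-identityʳ _
C-absorb-complement n (suc k) = begin
  suc n * (n C suc k) + suc k * (suc n C suc k)  ≡⟨ cong (suc n * (n C suc k) +_) (C-absorb n k) ⟨
  suc n * (n C suc k) + suc n * (n C k)          ≡⟨ *-distribˡ-+ (suc n) (n C suc k) _ ⟨
  suc n * (n C suc k + n C k)                    ≡⟨ cong (suc n *_) (+-comm (n C suc k) _) ⟩
  suc n * (n C k + n C suc k)                    ≡⟨ cong (suc n *_) (pascal n k) ⟨
  suc n * (suc n C suc k)                        ∎

-- dyck u h afterUp p counts U/D-paths with u up steps from height h down to the axis with p
-- peaks, afterUp saying that the step just before was U.
dyck     : ℕ → ℕ → Bool → ℕ → ℕ
dyckUp   : ℕ → ℕ → ℕ → ℕ
dyckDown : ℕ → ℕ → Bool → ℕ → ℕ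
dyckEnd  : ℕ → ℕ → ℕ → ℕ

dyck u h afterUp p = dyckUp u h p + dyckDown u h afterUp p + dyckEnd u h p

dyckUp zero    h p = 0
dyckUp (suc u) h p = dyck u (suc h) true p

dyckDown u zero    afterUp p       = 0
dyckDown u (suc h) false   p       = dyck u h false p
dyckDown u (suc h) true    zero    = 0
dyckDown u (suc h) true    (suc p) = dyck u h false p

dyckEnd zero zero zero = 1
dyckEnd _    _    _    = 0

dyck-noUps : ∀ h p → dyck 0 h false p ≡ 0 C p
dyck-noUps zero    zero    = refl
dyck-noUps zero    (suc p) = refl
dyck-noUps (suc h) p       = trans (+-identityʳ _) (dyck-noUps h p)

dyck-afterUp-noPeaks : ∀ u h → dyck u (suc h) true 0 ≡ 0
dyck-afterUp-noPeaks zero    h = refl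
dyck-afterUp-noPeaks (suc u) h = trans (+-identityʳ _) (trans (+-identityʳ _) (dyck-afterUp-noPeaks u (suc h)))

dyck-ups-noPeaks : ∀ u h → dyck (suc u) h false 0 ≡ 0
dyck-ups-noPeaks u zero    = trans (+-identityʳ _) (trans (+-identityʳ _) (dyck-afterUp-noPeaks u 0))
dyck-ups-noPeaks u (suc h) = trans (+-identityʳ _) (cong₂ _+_ (dyck-afterUp-noPeaks u (suc h)) (dyck-ups-noPeaks u h))

dyck-afterUp-onePeak : ∀ u h → dyck u (suc h) true 1 ≡ 1
dyck-afterUp-onePeak zero    h = trans (+-identityʳ _) (dyck-noUps h 0)
dyck-afterUp-onePeak (suc u) h = begin
  dyck u (suc (suc h)) true 1 + dyck (suc u) h false 0 + 0 ≡⟨ +-identityʳ _ ⟩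
  dyck u (suc (suc h)) true 1 + dyck (suc u) h false 0     ≡⟨ cong₂ _+_ (dyck-afterUp-onePeak u (suc h)) (dyck-ups-noPeaks u h) ⟩
  1                                                        ∎

-- Subtraction-free ballot-type closed forms; h = 0 in dyck-closed yields the Narayana numbers.
dyck-afterUp-closed : ∀ u h q →
  dyck u (suc h) true (suc q) + (u C suc q) * (suc (h + u) C q) ≡ (suc u C suc q) * ((h + u) C q)
dyck-closed : ∀ u h q →
  dyck (suc u) h false (suc q) + (u C suc q) * (suc (h + u) C q) ≡ (u C q) * (suc (h + u) C suc q)

dyck-afterUp-closed u h zero = begin
  dyck u (suc h) true 1 + (u C 1) * 1  ≡⟨ cong₂ (λ a b → a + b * 1) (dyck-afterUp-onePeak u h) (nC1≡n u) ⟩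
  suc u * 1                            ≡⟨ cong (_* 1) (nC1≡n (suc u)) ⟨
  (suc u C 1) * 1                      ∎
dyck-afterUp-closed zero h (suc q) = trans (+-identityʳ _) (trans (+-identityʳ _) (dyck-noUps h (suc q)))
dyck-afterUp-closed (suc u) h (suc q) rewrite +-suc h u =
  afterUp-step {t = dyck u (suc (suc h)) true (suc (suc q))} {f = dyck (suc u) h false (suc q)} {c₀ = u C q}
               (pascal (suc (h + u)) q) (pascal u (suc q)) (pascal u q) (pascal (suc u) (suc q))
               (dyck-afterUp-closed u (suc h) (suc q)) (dyck-closed u h q)
  where
  afterUp-step : ∀ {t f c₀ c₁ c₂ b₀ b₁ B d e E} → B ≡ b₀ + b₁ → d ≡ c₁ + c₂ → e ≡ c₀ + c₁ → E ≡ e + d →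
                 t + c₂ * B ≡ d * b₁ → f + c₁ * b₀ ≡ c₀ * b₁ → t + f + 0 + d * B ≡ E * b₁
  afterUp-step {t} {f} {c₀} {c₁} {c₂} {b₀} {b₁} refl refl refl refl ih₁ ih₂ = begin
    t + f + 0 + (c₁ + c₂) * (b₀ + b₁)               ≡⟨ solve (t ∷ f ∷ c₁ ∷ c₂ ∷ b₀ ∷ b₁ ∷ []) ⟩
    (t + c₂ * (b₀ + b₁)) + (f + c₁ * b₀) + c₁ * b₁  ≡⟨ cong₂ (λ a b → a + b + c₁ * b₁) ih₁ ih₂ ⟩
    (c₁ + c₂) * b₁ + c₀ * b₁ + c₁ * b₁              ≡⟨ solve (c₀ ∷ c₁ ∷ c₂ ∷ b₁ ∷ []) ⟩
    ((c₀ + c₁) + (c₁ + c₂)) * b₁                    ∎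

dyck-closed u zero q =
  trans (cong (_+ (u C suc q) * (suc u C q)) (trans (+-identityʳ _) (+-identityʳ _)))
        (trans (dyck-afterUp-closed u 0 q) (*-comm (suc u C suc q) (u C q)))
dyck-closed u (suc h) q =
  closed-step {t = dyck u (suc (suc h)) true (suc q)} {f = dyck (suc u) h false (suc q)} {c₀ = u C q}
              (pascal u q) (pascal (suc (h + u)) q) (dyck-afterUp-closed u (suc h) q) (dyck-closed u h q)
  where
  closed-step : ∀ {t f c₀ c₁ b₀ b₁ B B′ e} → e ≡ c₀ + c₁ → B′ ≡ b₀ + b₁ →
                t + c₁ * B ≡ e * b₀ → f + c₁ * b₀ ≡ c₀ * b₁ → t + f + 0 + c₁ * B ≡ c₀ * B′
  closed-step {t} {f} {c₀} {c₁} {b₀} {b₁} {B} refl refl ih₁ ih₂ = +-cancelʳ-≡ (c₁ * b₀) _ _ (begin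
    t + f + 0 + c₁ * B + c₁ * b₀          ≡⟨ solve (t ∷ f ∷ c₁ ∷ b₀ ∷ B ∷ []) ⟩
    (t + c₁ * B) + (f + c₁ * b₀)          ≡⟨ cong₂ _+_ ih₁ ih₂ ⟩
    (c₀ + c₁) * b₀ + c₀ * b₁              ≡⟨ solve (c₀ ∷ c₁ ∷ b₀ ∷ b₁ ∷ []) ⟩
    c₀ * (b₀ + b₁) + c₁ * b₀              ∎)

dyck-narayana : ∀ u p → dyck u 0 false p ≡ N u p
dyck-narayana zero    zero    = refl
dyck-narayana zero    (suc p) = refl
dyck-narayana (suc u) zero    = dyck-ups-noPeaks u 0
dyck-narayana (suc u) (suc q) = begin
  F                                           ≡⟨ m*n/n≡m F (suc u) ⟨
  F * suc u / suc u                           ≡⟨ cong (_/ suc u) (trans (*-comm F (suc u)) times-suc-u) ⟩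
  (suc u C suc q) * (suc u C q) / suc u       ∎
  where
  F = dyck (suc u) 0 false (suc q)
  times-suc-u : suc u * F ≡ (suc u C suc q) * (suc u C q)
  times-suc-u = narayana-step {n = suc u} {q} {F} {u C q} {u C suc q}
    (dyck-closed u 0 q) (C-absorb-complement u q) (C-absorb-complement u (suc q))
    where
    narayana-step : ∀ {n q F b₀ b₁ x y} → F + b₁ * y ≡ b₀ * x →
                    n * b₀ + q * y ≡ n * y → n * b₁ + suc q * x ≡ n * x → n * F ≡ x * y
    narayana-step {n} {q} {F} {b₀} {b₁} {x} {y} F₀ G₀ G₁ = +-cancelʳ-≡ (n * (x * y)) _ _ (begin
      n * F + n * (x * y)                   ≡⟨ solve (n ∷ F ∷ x ∷ y ∷ []) ⟩
      n * F + (n * x) * y                   ≡⟨ cong (λ t → n * F + t * y) G₁ ⟨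
      n * F + (n * b₁ + suc q * x) * y      ≡⟨ solve (n ∷ q ∷ F ∷ b₁ ∷ x ∷ y ∷ []) ⟩
      n * (F + b₁ * y) + suc q * (x * y)    ≡⟨ cong (λ t → n * t + suc q * (x * y)) F₀ ⟩
      n * (b₀ * x) + suc q * (x * y)        ≡⟨ solve (n ∷ q ∷ b₀ ∷ x ∷ y ∷ []) ⟩
      x * (n * b₀ + q * y) + x * y          ≡⟨ cong (λ t → x * t + x * y) G₀ ⟩
      x * (n * y) + x * y                   ≡⟨ solve (n ∷ x ∷ y ∷ []) ⟩
      x * y + n * (x * y)                   ∎)

regroup-first-steps : ∀ c₀ c₁ {x y z} → c₁ * z ≡ 0 →
                      c₁ * x + c₁ * y + c₀ * (x + y + z) ≡ (c₀ + c₁) * (x + y + z)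
regroup-first-steps c₀ c₁ {x} {y} {z} c₁z≡0 = begin
  c₁ * x + c₁ * y + c₀ * (x + y + z)          ≡⟨ +-identityʳ _ ⟨
  c₁ * x + c₁ * y + c₀ * (x + y + z) + 0      ≡⟨ cong (c₁ * x + c₁ * y + c₀ * (x + y + z) +_) c₁z≡0 ⟨
  c₁ * x + c₁ * y + c₀ * (x + y + z) + c₁ * z ≡⟨ solve (c₀ ∷ c₁ ∷ x ∷ y ∷ z ∷ []) ⟩
  (c₀ + c₁) * (x + y + z)                     ∎

length-after-D : ∀ a u h → a + (u + (u + suc h)) ≡ suc (a + (u + (u + h)))
length-after-D = solve-∀

binomial*dyckEnd≡0 : ∀ L a u h p → suc L ≡ a + (u + (u + h)) → (L C a) * dyckEnd u h p ≡ 0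
binomial*dyckEnd≡0 L a zero    zero    p eL =
  cong (_* dyckEnd 0 0 p) (k>n⇒nCk≡0 {L} {a} (≤-reflexive (trans eL (+-identityʳ a))))
binomial*dyckEnd≡0 L a zero    (suc h) p eL = *-zeroʳ (L C a)
binomial*dyckEnd≡0 L a (suc u) h       p eL = *-zeroʳ (L C a)

after-U-noUps : ∀ L m a h f p → suc L ≡ a + h → suc m ≡ a + 0 → after L U (config h (suc m) f p) ≡ 0
after-U-noUps L m a h f p eL em = paths-below L (suc h) m true p (s≤s (≤-reflexive (begin
  L          ≡⟨ suc-injective (trans eL (cong (_+ h) (trans (sym (+-identityʳ a)) (sym em)))) ⟩
  m + h      ≡⟨ +-comm m h ⟩
  h + m      ∎)))

after-H-noFlats : ∀ L m u h f p → suc L ≡ u + (u + h) → m ≡ u → after L H₂ (config h m f p) ≡ 0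
after-H-noFlats L zero    u h f p eL em   = refl
after-H-noFlats L (suc m) u h f p eL refl = paths-above L h m f p (≤-reflexive (sym (suc-injective (trans eL (shape m h)))))
  where shape : ∀ m h → suc m + (suc m + h) ≡ suc (suc (h + (m + m)))
        shape = solve-∀

-- a counts the flat steps and u the up steps: flat steps may sit anywhere among the L steps.
paths-factorises : ∀ L m a u h f p → L ≡ a + (u + (u + h)) → m ≡ a + u →
                   paths L (config h m f p) ≡ (L C a) * dyck u h f p
after-U : ∀ L m a u h f p → suc L ≡ a + (u + (u + h)) → m ≡ a + u →
          after L U (config h m f p) ≡ (L C a) * dyckUp u h p
after-D : ∀ L m a u h f p → suc L ≡ a + (u + (u + h)) → m ≡ a + u →
          after L D (config h m f p) ≡ (L C a) * dyckDown u h f p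
after-H : ∀ L m a u h f p → suc L ≡ suc a + (u + (u + h)) → m ≡ suc a + u →
          after L H₂ (config h m f p) ≡ (L C a) * dyck u h f p

paths-factorises zero .0 zero zero zero f zero    refl refl = refl
paths-factorises zero .0 zero zero zero f (suc p) refl refl = refl
paths-factorises zero m  zero zero (suc h) f p () em
paths-factorises zero m  zero (suc u) h f p () em
paths-factorises zero m  (suc a) u h f p () em
paths-factorises (suc L) m zero u h f p eL em = begin
  paths (suc L) (config h m f p)
    ≡⟨ cong₂ _+_ (cong₂ _+_ (after-U L m 0 u h f p eL em) (after-D L m 0 u h f p eL em))
                 (after-H-noFlats L m u h f p eL em) ⟩
  1 * dyckUp u h p + 1 * dyckDown u h f p + 0 * dyck u h f p
    ≡⟨ regroup-first-steps 0 1 {dyckUp u h p} (binomial*dyckEnd≡0 L 0 u h p eL) ⟩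
  1 * dyck u h f p
    ∎
paths-factorises (suc L) m (suc a) u h f p eL em = begin
  paths (suc L) (config h m f p)
    ≡⟨ cong₂ _+_ (cong₂ _+_ (after-U L m (suc a) u h f p eL em) (after-D L m (suc a) u h f p eL em))
                 (after-H L m a u h f p eL em) ⟩
  (L C suc a) * dyckUp u h p + (L C suc a) * dyckDown u h f p + (L C a) * dyck u h f p
    ≡⟨ regroup-first-steps (L C a) (L C suc a) (binomial*dyckEnd≡0 L (suc a) u h p eL) ⟩
  (L C a + L C suc a) * dyck u h f p
    ≡⟨ cong (_* dyck u h f p) (pascal L a) ⟨
  (suc L C suc a) * dyck u h f p
    ∎

after-U L zero    a zero    h f p eL em = sym (*-zeroʳ (L C a))
after-U L zero    a (suc u) h f p eL em = contradiction (trans em (+-suc a u)) 0≢1+n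
after-U L (suc m) a zero    h f p eL em = trans (after-U-noUps L m a h f p eL em) (sym (*-zeroʳ (L C a)))
after-U L (suc m) a (suc u) h f p eL em = paths-factorises L m a u (suc h) true p
  (suc-injective (trans eL (shape a u h))) (suc-injective (trans em (+-suc a u)))
  where shape : ∀ a u h → a + (suc u + (suc u + h)) ≡ suc (a + (u + (u + suc h)))
        shape = solve-∀

after-D L m a u zero    f     p       eL em = sym (*-zeroʳ (L C a))
after-D L m a u (suc h) false p       eL em =
  paths-factorises L m a u h false p (suc-injective (trans eL (length-after-D a u h))) em
after-D L m a u (suc h) true  zero    eL em = sym (*-zeroʳ (L C a))
after-D L m a u (suc h) true  (suc p) eL em =
  paths-factorises L m a u h false p (suc-injective (trans eL (length-after-D a u h))) em

after-H L (suc m) a u h f p eL em = paths-factorises L m a u h f p (suc-injective eL) (suc-injective em)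

avoidsUDpow : ℕ → ℕ → List Step → Bool
avoidsUDpow n k Q = (validFrom 0 Q ∧ (semilength Q ≡ᵇ n)) ∧ (peaks false Q <ᵇ k)

goodPath⇔avoidsUDpow : ∀ n k Q → GoodPath n (UDpow k) Q ⇔ T (avoidsUDpow n k Q)
goodPath⇔avoidsUDpow n k Q = mk⇔ to from
  where
  to : GoodPath n (UDpow k) Q → T (avoidsUDpow n k Q)
  to (valid , len , avoids) = Equivalence.from T-∧
    (Equivalence.from T-∧ (valid , ≡⇒≡ᵇ _ _ len) ,
     <⇒<ᵇ (≰⇒> (avoids ∘ Equivalence.from (UDpow⊆⇔≤peaks k Q))))
  from : T (avoidsUDpow n k Q) → GoodPath n (UDpow k) Q
  from t with Equivalence.to T-∧ t
  ... | t₁ , few with Equivalence.to T-∧ t₁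
  ... | valid , len = valid , ≡ᵇ⇒≡ _ _ len , <⇒≱ (<ᵇ⇒< _ _ few) ∘ Equivalence.to (UDpow⊆⇔≤peaks k Q)

fewPeakPaths : ℕ → ℕ → ℕ → ℕ
fewPeakPaths n k L = sumBelow k (λ p → paths L (config 0 n false p))

count-avoidsUDpow : ∀ n k L → count (avoidsUDpow n k) (wordsOfLength L) ≡ fewPeakPaths n k L
count-avoidsUDpow n k L =
  trans (count-<ᵇ (λ Q → validFrom 0 Q ∧ (semilength Q ≡ᵇ n)) (peaks false) k (wordsOfLength L))
        (sumBelow-cong k λ p → trans (count-cong (λ Q → sym (accepts-config 0 n false p Q)) (wordsOfLength L))
                                     (count-accepts L (config 0 n false p)))

s≡sum-fewPeakPaths : ∀ n k → s n (UDpow k) ≡ sumTo (2 * n) (fewPeakPaths n k)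
s≡sum-fewPeakPaths n k = begin
  s n (UDpow k)
    ≡⟨ length-filter≡count (goodPath? n (UDpow k)) (avoidsUDpow n k) (goodPath⇔avoidsUDpow n k) (wordsUpTo (2 * n)) ⟩
  count (avoidsUDpow n k) (wordsUpTo (2 * n))
    ≡⟨ count-concatMap (avoidsUDpow n k) wordsOfLength (upTo (suc (2 * n))) ⟩
  sum (map (count (avoidsUDpow n k) ∘ wordsOfLength) (upTo (suc (2 * n))))
    ≡⟨ sum-map-upTo (count (avoidsUDpow n k) ∘ wordsOfLength) (2 * n) ⟩
  sumTo (2 * n) (count (avoidsUDpow n k) ∘ wordsOfLength)
    ≡⟨ sumTo-cong (2 * n) (λ L _ → count-avoidsUDpow n k L) ⟩
  sumTo (2 * n) (fewPeakPaths n k)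
    ∎

paths≡binomial*narayana : ∀ n h p → h ≤ n →
                          paths (n + h) (config 0 n false p) ≡ ((n + h) C (n ∸ h)) * N h p
paths≡binomial*narayana n h p h≤n =
  trans (paths-factorises (n + h) n (n ∸ h) h 0 false p eL em)
        (cong (((n + h) C (n ∸ h)) *_) (dyck-narayana h p))
  where
  em : n ≡ (n ∸ h) + h
  em = sym (m∸n+n≡m h≤n)
  eL : n + h ≡ (n ∸ h) + (h + (h + 0))
  eL = trans (cong (_+ h) em) (shape (n ∸ h) h)
    where shape : ∀ a h → a + h + h ≡ a + (h + (h + 0))
          shape = solve-∀

mainTheorem4 : (n k : ℕ) →
    s n (UDpow k) ≡ sumTo n (λ h → sumBelow k (λ j → ((n + h) C (n ∸ h)) * N h j))
mainTheorem4 n k = begin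
  s n (UDpow k)                          ≡⟨ s≡sum-fewPeakPaths n k ⟩
  sumTo (n + (n + 0)) (fewPeakPaths n k) ≡⟨ cong (λ t → sumTo (n + t) (fewPeakPaths n k)) (+-identityʳ n) ⟩
  sumTo (n + n) (fewPeakPaths n k)
    ≡⟨ sumTo-+ n n (λ L L<n → sumBelow-zero k (λ p → paths-below L 0 n false p L<n)) ⟩
  sumTo n (λ h → fewPeakPaths n k (n + h))
    ≡⟨ sumTo-cong n (λ h h≤n → sumBelow-cong k (λ p → paths≡binomial*narayana n h p h≤n)) ⟩
  sumTo n (λ h → sumBelow k (λ j → ((n + h) C (n ∸ h)) * N h j))
    ∎
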